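{- Let $C,D$ be constructors and $v,w$ values. If $C\neq D$ then $C[v]\not\equiv D[w]$.
   Context: Fix pairwise disjoint countably infinite sets of $\lambda$-variables ($x,y,\dots$), stack variables ($\alpha,\beta,\dots$), term variables ($a,b,\dots$), and countable sets of labels $l$ and constructors $C$. Values, terms, stacks, processes: $v,w::=x\mid\lambda x\,t\mid C[v]\mid\{l_i=v_i\}_{i\in I}$; $t,u::=a\mid v\mid t\,u\mid\mu\alpha\,t\mid p\mid v.l\mid\mathrm{case}_v[C_i[x_i]\to t_i]_{i\in I}\mid\delta_{v,w}$; $\pi::=\alpha\mid v.\pi\mid[t]\pi$; $p::=t\ast\pi$; $I$ finite; $\lambda x$, $\mu\alpha$ and the $x_i$ in case branches are binders, term variables are never bound. Substitutions map $\lambda$-variables to values, stack variables to stacks, term variables to terms (capture-avoiding). $\succ$ is the smallest relation on processes with: $t\,u\ast\pi\succ u\ast[t]\pi$; $v\ast[t]\pi\succ t\ast v.\pi$; $\lambda x\,t\ast v.\pi\succ t[x:=v]\ast\pi$; $\mu\alpha\,t\ast\pi\succ t[\alpha:=\pi]\ast\pi$; $p\ast\pi\succ p$; $\{l_i=v_i\}_{i\in I}.l_k\ast\pi\succ v_k\ast\pi$ ($k\in I$); $\mathrm{case}_{C_k[v]}[C_i[x_i]\to t_i]_{i\in I}\ast\pi\succ t_k[x_k:=v]\ast\pi$ ($k\in I$). A process is final if it is $v\ast\alpha$ with $v$ a value and $\alpha$ a stack variable; for a relation $R$, $p\Downarrow_R$ means $p\,R^*\,q$ with $q$ final. For $i\in\mathbb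 N$, inductively: $\rightsquigarrow_i=\succ\cup\{(\delta_{v,w}\ast\pi,v\ast\pi)\mid\exists j<i,\ v\not\equiv_jw\}$; $t\equiv_iu$ iff for all $j\le i$, stacks $\pi$, substitutions $\sigma$: $t\sigma\ast\pi\Downarrow_{\rightsquigarrow_j}\Leftrightarrow u\sigma\ast\pi\Downarrow_{\rightsquigarrow_j}$; $\not\equiv_i$ is its negation. $\equiv=\bigcap_i\equiv_i$ and $\not\equiv$ is its negation. -}

module Defs where

open import Data.Nat using (ℕ; zero; suc)
open import Data.Product using (Σ; _×_; _,_)
open import Data.Sum using (_⊎_)
open import Data.Empty using (⊥)
open import Relation.Nullary using (¬_)
open import Relation.Binary.Construct.Closure.ReflexiveTransitive using (Star)

-- Syntax.  λ-variables and stack variables are de Bruijn indices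
-- (binders: λ, the variable of a case branch, μ).  Term variables are
-- never bound and are named by natural numbers.

Label : Set
Label = ℕ

Cons : Set
Cons = ℕ

mutual
  data Val : Set where
    var : ℕ → Val
    lam : Term → Val
    con : Cons → Val → Val
    rec : Fields → Val

  data Fields : Set where
    fnil  : Fields
    fcons : Label → Val → Fields → Fields

  data Term : Set where
    tvar  : ℕ → Term
    val   : Val → Term
    app   : Term → Term → Term
    mu    : Term → Term
    proc  : Proc → Term
    proj  : Val → Label → Term
    cas   : Val → Branches → Term
    delta : Val → Val → Term

  -- finite family of case branches C_i[x_i] → t_i (x_i = λ-index 0 in t_i)
  data Branches : Set where
    bnil  : Branches
    bcons : Cons → Term → Branches → Branches

  data Stack : Set where
    svar  : ℕ → Stack
    push  : Val → Stack → Stack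
    frame : Term → Stack → Stack

  data Proc : Set where
    _∗_ : Term → Stack → Proc

infix 4 _∗_

record Ren : Set where
  field
    rλ : ℕ → ℕ
    rα : ℕ → ℕ
open Ren public

ext : (ℕ → ℕ) → ℕ → ℕ
ext r zero    = zero
ext r (suc n) = suc (r n)

liftλR : Ren → Ren
liftλR ρ = record { rλ = ext (rλ ρ) ; rα = rα ρ }

liftαR : Ren → Ren
liftαR ρ = record { rλ = rλ ρ ; rα = ext (rα ρ) }

mutual
  renV : Ren → Val → Val
  renV ρ (var x)   = var (rλ ρ x)
  renV ρ (lam t)   = lam (renT (liftλR ρ) t)
  renV ρ (con C v) = con C (renV ρ v)
  renV ρ (rec fs)  = rec (renF ρ fs)

  renF : Ren → Fields → Fields
  renF ρ fnil           = fnil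
  renF ρ (fcons l v fs) = fcons l (renV ρ v) (renF ρ fs)

  renT : Ren → Term → Term
  renT ρ (tvar a)    = tvar a
  renT ρ (val v)     = val (renV ρ v)
  renT ρ (app t u)   = app (renT ρ t) (renT ρ u)
  renT ρ (mu t)      = mu (renT (liftαR ρ) t)
  renT ρ (proc p)    = proc (renP ρ p)
  renT ρ (proj v l)  = proj (renV ρ v) l
  renT ρ (cas v bs)  = cas (renV ρ v) (renB ρ bs)
  renT ρ (delta v w) = delta (renV ρ v) (renV ρ w)

  renB : Ren → Branches → Branches
  renB ρ bnil            = bnil
  renB ρ (bcons C t bs)  = bcons C (renT (liftλR ρ) t) (renB ρ bs)

  renS : Ren → Stack → Stack
  renS ρ (svar α)    = svar (rα ρ α)
  renS ρ (push v π)  = push (renV ρ v) (renS ρ π)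
  renS ρ (frame t π) = frame (renT ρ t) (renS ρ π)

  renP : Ren → Proc → Proc
  renP ρ (t ∗ π) = renT ρ t ∗ renS ρ π

wkλ : Ren
wkλ = record { rλ = suc ; rα = λ n → n }

wkα : Ren
wkα = record { rλ = λ n → n ; rα = suc }

record Sub : Set where
  field
    sλ : ℕ → Val
    sα : ℕ → Stack
    sa : ℕ → Term
open Sub public

liftλS : Sub → Sub
liftλS σ = record
  { sλ = λ { zero → var zero ; (suc n) → renV wkλ (sλ σ n) }
  ; sα = λ n → renS wkλ (sα σ n)
  ; sa = λ a → renT wkλ (sa σ a) }

liftαS : Sub → Sub
liftαS σ = record
  { sλ = λ n → renV wkα (sλ σ n)
  ; sα = λ { zero → svar zero ; (suc n) → renS wkα (sα σ n) }
  ; sa = λ a → renT wkα (sa σ a) }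

mutual
  subV : Sub → Val → Val
  subV σ (var x)   = sλ σ x
  subV σ (lam t)   = lam (subT (liftλS σ) t)
  subV σ (con C v) = con C (subV σ v)
  subV σ (rec fs)  = rec (subF σ fs)

  subF : Sub → Fields → Fields
  subF σ fnil           = fnil
  subF σ (fcons l v fs) = fcons l (subV σ v) (subF σ fs)

  subT : Sub → Term → Term
  subT σ (tvar a)    = sa σ a
  subT σ (val v)     = val (subV σ v)
  subT σ (app t u)   = app (subT σ t) (subT σ u)
  subT σ (mu t)      = mu (subT (liftαS σ) t)
  subT σ (proc p)    = proc (subP σ p)
  subT σ (proj v l)  = proj (subV σ v) l
  subT σ (cas v bs)  = cas (subV σ v) (subB σ bs)
  subT σ (delta v w) = delta (subV σ v) (subV σ w)

  subB : Sub → Branches → Branches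
  subB σ bnil           = bnil
  subB σ (bcons C t bs) = bcons C (subT (liftλS σ) t) (subB σ bs)

  subS : Sub → Stack → Stack
  subS σ (svar α)    = sα σ α
  subS σ (push v π)  = push (subV σ v) (subS σ π)
  subS σ (frame t π) = frame (subT σ t) (subS σ π)

  subP : Sub → Proc → Proc
  subP σ (t ∗ π) = subT σ t ∗ subS σ π

single : Val → Sub
single v = record
  { sλ = λ { zero → v ; (suc n) → var n } ; sα = svar ; sa = tvar }

singleα : Stack → Sub
singleα π = record
  { sλ = var ; sα = λ { zero → π ; (suc n) → svar n } ; sa = tvar }

data FieldIn (l : Label) (v : Val) : Fields → Set where
  here  : ∀ {fs} → FieldIn l v (fcons l v fs)
  there : ∀ {l' v' fs} → FieldIn l v fs → FieldIn l v (fcons l' v' fs)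

data BranchIn (C : Cons) (t : Term) : Branches → Set where
  here  : ∀ {bs} → BranchIn C t (bcons C t bs)
  there : ∀ {C' t' bs} → BranchIn C t bs → BranchIn C t (bcons C' t' bs)

infix 3 _≻_
data _≻_ : Proc → Proc → Set where
  ≻-app   : ∀ {t u π} → app t u ∗ π ≻ u ∗ frame t π
  ≻-frame : ∀ {v t π} → val v ∗ frame t π ≻ t ∗ push v π
  ≻-lam   : ∀ {t v π} → val (lam t) ∗ push v π ≻ subT (single v) t ∗ π
  ≻-mu    : ∀ {t π} → mu t ∗ π ≻ subT (singleα π) t ∗ π
  ≻-proc  : ∀ {p π} → proc p ∗ π ≻ p
  ≻-proj  : ∀ {fs l v π} → FieldIn l v fs → proj (rec fs) l ∗ π ≻ val v ∗ π
  ≻-case  : ∀ {C v bs t π} → BranchIn C t bs →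
            cas (con C v) bs ∗ π ≻ subT (single v) t ∗ π

data Final : Proc → Set where
  final : ∀ v α → Final (val v ∗ svar α)

Halts : (Proc → Proc → Set) → Proc → Set
Halts R p = Σ Proc (λ q → Star R p q × Final q)

data StepWith (N : Val → Val → Set) : Proc → Proc → Set where
  red   : ∀ {p q} → p ≻ q → StepWith N p q
  δ-red : ∀ {v w π} → N v w → StepWith N (delta v w ∗ π) (val v ∗ π)

EqWith : (Val → Val → Set) → Term → Term → Set
EqWith N t u = (π : Stack) (σ : Sub) →
  (Halts (StepWith N) (subT σ t ∗ π) → Halts (StepWith N) (subT σ u ∗ π)) ×
  (Halts (StepWith N) (subT σ u ∗ π) → Halts (StepWith N) (subT σ t ∗ π))

-- Dist i v w  ⟺  ∃ j < i, v ≢_j w      (bounded ∃ unfolded)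
--   Eqv i t u   ⟺  t ≡_i u  = ∀ j ≤ i, EqWith (Dist j) t u  (bounded ∀ unfolded)
--   ⇝_i = StepWith (Dist i)

mutual
  Dist : ℕ → Val → Val → Set
  Dist zero    v w = ⊥
  Dist (suc i) v w = Dist i v w ⊎ ¬ Eqv i (val v) (val w)

  Eqv : ℕ → Term → Term → Set
  Eqv zero    t u = EqWith (Dist zero) t u
  Eqv (suc i) t u = Eqv i t u × EqWith (Dist (suc i)) t u

Step : ℕ → Proc → Proc → Set
Step i = StepWith (Dist i)

Equiv : Term → Term → Set
Equiv t u = (i : ℕ) → Eqv i t u

module Submission where

-- The argument is a separating context that works already at level 0.
-- The "selector" for C is the stack  [λx. case x [C[y] → y]] α.
--   * Against C[v] it reduces in three steps to the final process v ∗ α.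
--   * Against D[w] it reduces to  case D[w] [C[y] → y] ∗ α, which has no
--     matching branch and is not final; since each intermediate process has
--     exactly one reduct, the run cannot halt.
-- None of this involves a δ-redex, so both facts hold for the reduction
-- relation extended by ANY distinctness relation N.  The theorem follows by
-- instantiating the level-0 condition of C[v] ≡ D[w] at the selector stack
-- and the identity substitution.

open import Defs
open import Relation.Nullary using (¬_)
open import Relation.Binary.PropositionalEquality using (_≢_; _≡_; refl)
open import Relation.Binary.Construct.Closure.ReflexiveTransitive using (ε; _◅_)
open import Data.Product using (_,_; proj₁)
open import Function using (_∘_)
open import Data.Empty using (⊥-elim)

stuck⇒¬halts : ∀ {R : Proc → Proc → Set} {p} →
  (∀ {q} → ¬ R p q) → ¬ Final p → ¬ Halts R p
stuck⇒¬halts stuck nonfinal (_ , ε , fin)    = nonfinal fin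
stuck⇒¬halts stuck nonfinal (_ , r ◅ _ , _) = stuck r

halts-forced : ∀ {R : Proc → Proc → Set} {p p'} →
  ¬ Final p → (∀ {q} → R p q → q ≡ p') → Halts R p → Halts R p'
halts-forced nonfinal forced (_ , ε , fin)         = ⊥-elim (nonfinal fin)
halts-forced nonfinal forced (q , r ◅ run , fin) with forced r
... | refl = q , run , fin

idSub : Sub
idSub = record { sλ = var ; sα = svar ; sa = tvar }

projBranch : Cons → Branches
projBranch C = bcons C (val (var 0)) bnil

selector : Cons → Stack
selector C = frame (val (lam (cas (var 0) (projBranch C)))) (svar 0)

selector-accepts : ∀ {N} C v → Halts (StepWith N) (val (con C v) ∗ selector C)
selector-accepts C v =
  (val v ∗ svar 0) , red ≻-frame ◅ red ≻-lam ◅ red (≻-case here) ◅ ε , final v 0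

mismatched-case-stuck : ∀ {N C D w π q} → C ≢ D →
  ¬ StepWith N (cas (con D w) (projBranch C) ∗ π) q
mismatched-case-stuck C≢D (red (≻-case here))       = C≢D refl
mismatched-case-stuck C≢D (red (≻-case (there ())))

selector-rejects : ∀ {N C D} w → C ≢ D →
  ¬ Halts (StepWith N) (val (con D w) ∗ selector C)
selector-rejects w C≢D =
  stuck⇒¬halts (mismatched-case-stuck C≢D) (λ ())
  ∘ halts-forced (λ ()) (λ { (red ≻-lam) → refl })
  ∘ halts-forced (λ ()) (λ { (red ≻-frame) → refl })

theorem11 : (C D : Cons) (v w : Val) → C ≢ D →
    ¬ Equiv (val (con C v)) (val (con D w))
theorem11 C D v w C≢D equiv =
  selector-rejects (subV idSub w) C≢D
    (proj₁ (equiv 0 (selector C) idSub) (selector-accepts C (subV idSub v)))
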